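{- Let $A,B$ be an instance of $2$-Max-Duo and let $G=(V,E)$ be the graph constructed from it as described in the context. If $G$ contains no square, then every vertex of degree $5$ in $G$ is adjacent to a vertex of degree $1$.
   Context: $A=(a_1,\dots,a_n)$ and $B=(b_1,\dots,b_n)$ are strings such that $B$ is a permutation of $A$ and every letter occurs at most twice in each of $A$ and $B$. $H=(A,B,F)$ is the bipartite graph with vertex classes $a_1,\dots,a_n$ and $b_1,\dots,b_n$, and an edge $e_{i,j}$ between $a_i$ and $b_j$ if and only if the letters $a_i$ and $b_j$ are equal. $G=(V,E)$ has vertex set $V=\{v_{i,j}: 1\le i,j\le n-1,\ e_{i,j},e_{i+1,j+1}\in F\}$. Two distinct vertices are adjacent if and only if their corresponding pairs of edges $(e_{i,j},e_{i+1,j+1})$ cannot both be contained in a common perfect matching of $H$. A square is the subgraph induced on four vertices $v_{i,j},v_{i,j'},v_{i',j},v_{i',j'}\in V$ with $i\ne i'$ and $j\ne j'$. -}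

module Defs where

open import Data.Nat using (ℕ; suc; _<_)
open import Data.Fin using (Fin; toℕ; fromℕ<)
open import Data.Fin.Permutation using (Permutation′; _⟨$⟩ʳ_)
open import Data.Product using (Σ; _×_; _,_; ∃)
open import Data.List using (List; length)
open import Data.List.Relation.Unary.Unique.Propositional using (Unique)
open import Data.List.Membership.Propositional using (_∈_)
open import Relation.Binary.PropositionalEquality using (_≡_; _≢_)
open import Relation.Nullary using (¬_)
open import Function.Bundles using (_⇔_)

-- A string of length n over an alphabet L: positions are Fin n (0-indexed).
Str : Set → ℕ → Set
Str L n = Fin n → L

IsPermOf : {L : Set} {n : ℕ} → Str L n → Str L n → Set
IsPermOf {n = n} a b = Σ (Permutation′ n) λ σ → ∀ k → b k ≡ a (σ ⟨$⟩ʳ k)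

AtMostTwice : {L : Set} {n : ℕ} → Str L n → Set
AtMostTwice {n = n} a = (k₁ k₂ k₃ : Fin n) → k₁ ≢ k₂ → k₁ ≢ k₃ → k₂ ≢ k₃ →
  ¬ (a k₁ ≡ a k₂ × a k₂ ≡ a k₃)

EdgeH : {L : Set} {n : ℕ} → Str L n → Str L n → ℕ → ℕ → Set
EdgeH {n = n} a b i j =
  Σ (i < n) λ i< → Σ (j < n) λ j< → a (fromℕ< i<) ≡ b (fromℕ< j<)

-- A perfect matching of H, given as a bijection π : positions of A → positions
-- of B such that every matched pair is an edge of H.
PerfectMatching : {L : Set} {n : ℕ} → Str L n → Str L n → Set
PerfectMatching {n = n} a b = Σ (Permutation′ n) λ π → ∀ k → a k ≡ b (π ⟨$⟩ʳ k)

Contains : {L : Set} {n : ℕ} (a b : Str L n) → PerfectMatching a b → ℕ → ℕ → Set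
Contains {n = n} a b (π , _) i j = Σ (Fin n) λ k → toℕ k ≡ i × toℕ (π ⟨$⟩ʳ k) ≡ j

Vtx : Set
Vtx = ℕ × ℕ

-- v_{i,j} ∈ V  iff  e_{i,j}, e_{i+1,j+1} ∈ F  (0-indexed, so automatically
-- i, j ≤ n-2, i.e. 1 ≤ i,j ≤ n-1 in the paper's 1-indexing).
InV : {L : Set} {n : ℕ} → Str L n → Str L n → Vtx → Set
InV a b (i , j) = EdgeH a b i j × EdgeH a b (suc i) (suc j)

Compatible : {L : Set} {n : ℕ} → Str L n → Str L n → Vtx → Vtx → Set
Compatible a b (i , j) (i' , j') = Σ (PerfectMatching a b) λ M →
  Contains a b M i j × Contains a b M (suc i) (suc j) ×
  Contains a b M i' j' × Contains a b M (suc i') (suc j')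

Adj : {L : Set} {n : ℕ} → Str L n → Str L n → Vtx → Vtx → Set
Adj a b v w = v ≢ w × ¬ Compatible a b v w

HasDegree : {L : Set} {n : ℕ} → Str L n → Str L n → Vtx → ℕ → Set
HasDegree a b v d = Σ (List Vtx) λ ns →
  length ns ≡ d × Unique ns × (∀ w → (w ∈ ns) ⇔ (InV a b w × Adj a b v w))

HasSquare : {L : Set} {n : ℕ} → Str L n → Str L n → Set
HasSquare a b = Σ ℕ λ i → Σ ℕ λ i' → Σ ℕ λ j → Σ ℕ λ j' →
  i ≢ i' × j ≢ j' ×
  InV a b (i , j) × InV a b (i , j') × InV a b (i' , j) × InV a b (i' , j')

module Submission where

-- The vertex v_{i,j} owns the H-edges (i , j) and (i+1 , j+1).  First,
-- adjacency is made explicit: v and u are adjacent iff an edge of u shares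
-- exactly one endpoint with an edge of v, since pairwise non-conflicting edges
-- always extend to a perfect matching (swap partners inside a letter class).
-- Such a conflict puts u into one of five slots of v: same row or column, row
-- just above, column just left, row just below, column just right.
-- Second, for any relation "a_p = b_q" closed under rectangles, meeting rows
-- and columns at most twice and without squares, each slot holds at most one
-- vertex; so degree 5 fills every slot (pigeonhole), and then the occupant w
-- of the row/column slot has v as its only neighbour, since every other
-- candidate would close a square.  The column case is the row case of the
-- transposed relation.

open import Defs
open import Data.Nat using (ℕ; suc; _<_; _≟_)
open import Data.Nat.Properties using (1+n≰n; suc-injective)
open import Data.Fin using (Fin; toℕ; fromℕ<; punchOut)
open import Data.Fin.Properties
  using (toℕ-injective; toℕ-fromℕ<; fromℕ<-cong; fromℕ<-injective; any?;
         injective⇒≤; punchOut-injective)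
  renaming (_≟_ to _≟ᶠ_)
open import Data.Fin.Permutation using (Permutation′; _⟨$⟩ʳ_; _⟨$⟩ˡ_; inverseʳ; transpose; _∘ₚ_; flip)
import Data.Fin.Permutation.Components as PC
open import Data.Product using (Σ; ∃; _×_; _,_; proj₁; proj₂; swap)
open import Data.Sum using (_⊎_; inj₁; inj₂)
open import Data.Empty using (⊥; ⊥-elim)
open import Data.List using (List; []; _∷_; length; lookup)
open import Data.List.Relation.Unary.All as All using (All; []; _∷_)
open import Data.List.Relation.Unary.AllPairs using (AllPairs; []; _∷_)
open import Data.List.Relation.Unary.Unique.Propositional using (Unique)
open import Data.List.Relation.Unary.Any using (here)
open import Data.List.Membership.Propositional using (_∈_)
open import Data.List.Membership.Propositional.Properties using (∈-lookup)
open import Function using (_∘_)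
open import Function.Bundles using (Injection; mk⇔; Equivalence)
open import Function.Definitions using (Injective)
open import Function.Properties.Inverse using (↔⇒↣)
open import Relation.Nullary using (¬_; yes; no; contradiction)
open import Relation.Binary.PropositionalEquality
  using (_≡_; _≢_; refl; sym; trans; cong; subst; ≢-sym; module ≡-Reasoning)

variable
  i j p q r i' j' p' q' : ℕ
  s : Fin 5
  u u' v x y : Vtx

next : Vtx → Vtx
next (i , j) = suc i , suc j

Conflict : Vtx → Vtx → Set
Conflict (p , q) (p' , q') = (p ≡ p' × q ≢ q') ⊎ (p ≢ p' × q ≡ q')

-- Two edges are coherent when they share both endpoints or none; this is the
-- negation of conflict, stated positively for any type of endpoints.
Coherent : {A : Set} → A × A → A × A → Set
Coherent (p , q) (p' , q') = (p ≡ p' → q ≡ q') × (q ≡ q' → p ≡ p')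

coherent-sym : {A : Set} {e e' : A × A} → Coherent e e' → Coherent e' e
coherent-sym (row , col) = (λ eq → sym (row (sym eq))) , (λ eq → sym (col (sym eq)))

coherent-next : ∀ x → Coherent x (next x)
coherent-next (p , q) = (λ ()) , (λ ())

conflict-or-coherent : ∀ x y → Conflict x y ⊎ Coherent x y
conflict-or-coherent (p , q) (p' , q') with p ≟ p' | q ≟ q'
... | yes p≡ | yes q≡ = inj₂ ((λ _ → q≡) , (λ _ → p≡))
... | yes p≡ | no q≢  = inj₁ (inj₁ (p≡ , q≢))
... | no p≢  | yes q≡ = inj₁ (inj₂ (p≢ , q≡))
... | no p≢  | no q≢  = inj₂ ((λ p≡ → ⊥-elim (p≢ p≡)) , (λ q≡ → ⊥-elim (q≢ q≡)))

pattern line  = Fin.zero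
pattern up    = Fin.suc Fin.zero
pattern left  = Fin.suc (Fin.suc Fin.zero)
pattern down  = Fin.suc (Fin.suc (Fin.suc Fin.zero))
pattern right = Fin.suc (Fin.suc (Fin.suc (Fin.suc Fin.zero)))

-- Slot s v u: some edge of u conflicts with some edge of v, in the manner s.
--   line : u shares the row or the column of v (both edges, by translation);
--   up   : the second edge of u lies in the first row of v, and left likewise
--          for columns;
--   down : the first edge of u lies in the second row of v, and right likewise.
data Slot : Fin 5 → Vtx → Vtx → Set where
  sameRow  : q ≢ j → Slot line (i , j) (i , q)
  sameCol  : p ≢ i → Slot line (i , j) (p , j)
  rowAbove : suc q ≢ j → Slot up (suc p , j) (p , q)
  colLeft  : suc p ≢ i → Slot left (i , suc q) (p , q)
  rowBelow : q ≢ suc j → Slot down (i , j) (suc i , q)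
  colRight : p ≢ suc i → Slot right (i , j) (p , suc j)

slot⇒≢ : Slot s v u → v ≢ u
slot⇒≢ (sameRow q≢j) = q≢j ∘ sym ∘ cong proj₂
slot⇒≢ (sameCol p≢i) = p≢i ∘ sym ∘ cong proj₁
slot⇒≢ (rowAbove _)  = λ ()
slot⇒≢ (colLeft _)   = λ ()
slot⇒≢ (rowBelow _)  = λ ()
slot⇒≢ (colRight _)  = λ ()

slot-first-first : Conflict v u → Σ (Fin 5) λ s → Slot s v u
slot-first-first (inj₁ (refl , j≢q)) = line , sameRow (≢-sym j≢q)
slot-first-first (inj₂ (i≢p , refl)) = line , sameCol (≢-sym i≢p)

slot-first-second : ∀ u → Conflict v (next u) → Σ (Fin 5) λ s → Slot s v u
slot-first-second _ (inj₁ (refl , j≢)) = up , rowAbove (≢-sym j≢)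
slot-first-second _ (inj₂ (i≢ , refl)) = left , colLeft (≢-sym i≢)

slot-second-first : ∀ v → Conflict (next v) u → Σ (Fin 5) λ s → Slot s v u
slot-second-first _ (inj₁ (refl , j≢)) = down , rowBelow (≢-sym j≢)
slot-second-first _ (inj₂ (i≢ , refl)) = right , colRight (≢-sym i≢)

slot-second-second : ∀ v u → Conflict (next v) (next u) → Σ (Fin 5) λ s → Slot s v u
slot-second-second _ _ (inj₁ (refl , j≢)) = line , sameRow (≢-sym (j≢ ∘ cong suc))
slot-second-second _ _ (inj₂ (i≢ , refl)) = line , sameCol (≢-sym (i≢ ∘ cong suc))

swapSlot : Fin 5 → Fin 5
swapSlot line  = line
swapSlot up    = left
swapSlot left  = up
swapSlot down  = right
swapSlot right = down

slot-swap : Slot s v u → Slot (swapSlot s) (swap v) (swap u)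
slot-swap (sameRow q≢j)  = sameCol q≢j
slot-swap (sameCol p≢i)  = sameRow p≢i
slot-swap (rowAbove q≢j) = colLeft q≢j
slot-swap (colLeft p≢i)  = rowAbove p≢i
slot-swap (rowBelow q≢j) = colRight q≢j
slot-swap (colRight p≢i) = rowBelow p≢i

transpose-cases : ∀ {n} (k k' t : Fin n) →
  (t ≡ k × PC.transpose k k' t ≡ k') ⊎
  (t ≢ k × t ≡ k' × PC.transpose k k' t ≡ k) ⊎
  (t ≢ k × t ≢ k' × PC.transpose k k' t ≡ t)
transpose-cases k k' t with t ≟ᶠ k
... | yes t≡k = inj₁ (t≡k , refl)
... | no t≢k with t ≟ᶠ k'
...   | yes t≡k' = inj₂ (inj₁ (t≢k , t≡k' , refl))
...   | no t≢k'  = inj₂ (inj₂ (t≢k , t≢k' , refl))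

module Matchings {L : Set} {n : ℕ} (a b : Str L n) where

  Edge : Set
  Edge = Σ (Fin n × Fin n) λ km → a (proj₁ km) ≡ b (proj₂ km)

  Uses : PerfectMatching a b → Edge → Set
  Uses (π , _) ((k , m) , _) = π ⟨$⟩ʳ k ≡ m

  -- Any edge e = (k , m) can be forced into a perfect matching π by swapping
  -- the partners of k and of π⁻¹ m; every edge coherent with e is kept.
  -- This works because a_k, a_{π⁻¹ m} and b_m are all the same letter.
  reassign : (M : PerfectMatching a b) (e : Edge) →
    Σ (PerfectMatching a b) λ M' →
      Uses M' e × (∀ {e'} → Uses M e' → Coherent (proj₁ e') (proj₁ e) → Uses M' e')
  reassign (π , π-ok) ((k , m) , ak≡bm) = (π' , π'-ok) , uses-e , λ {e'} → keeps {e'}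
    where
    open ≡-Reasoning
    k' : Fin n
    k' = π ⟨$⟩ˡ m
    πk'≡m : π ⟨$⟩ʳ k' ≡ m
    πk'≡m = inverseʳ π
    π' : Permutation′ n
    π' = transpose k k' ∘ₚ π
    π'-ok : ∀ t → a t ≡ b (π' ⟨$⟩ʳ t)
    π'-ok t with transpose-cases k k' t
    ... | inj₁ (refl , τ) rewrite τ | πk'≡m = ak≡bm
    ... | inj₂ (inj₁ (_ , refl , τ)) rewrite τ = begin
      a k'             ≡⟨ π-ok k' ⟩
      b (π ⟨$⟩ʳ k')   ≡⟨ cong b πk'≡m ⟩
      b m              ≡⟨ sym ak≡bm ⟩
      a k              ≡⟨ π-ok k ⟩
      b (π ⟨$⟩ʳ k)    ∎
    ... | inj₂ (inj₂ (_ , _ , τ)) rewrite τ = π-ok t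
    uses-e : π' ⟨$⟩ʳ k ≡ m
    uses-e with transpose-cases k k' k
    ... | inj₁ (_ , τ) rewrite τ = πk'≡m
    ... | inj₂ (inj₁ (k≢k , _)) = contradiction refl k≢k
    ... | inj₂ (inj₂ (k≢k , _)) = contradiction refl k≢k
    keeps : ∀ {e'} → Uses (π , π-ok) e' → Coherent (proj₁ e') (k , m) → Uses (π' , π'-ok) e'
    keeps {(t , t') , _} πt≡t' (row , col) with transpose-cases k k' t
    ... | inj₁ (refl , τ) rewrite τ = trans πk'≡m (sym (row refl))
    ... | inj₂ (inj₁ (t≢k , refl , _)) = contradiction (col (trans (sym πt≡t') πk'≡m)) t≢k
    ... | inj₂ (inj₂ (_ , _ , τ)) rewrite τ = πt≡t'

  extend : PerfectMatching a b → (es : List Edge) →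
    AllPairs (λ e e' → Coherent (proj₁ e) (proj₁ e')) es →
    Σ (PerfectMatching a b) λ M → All (Uses M) es
  extend M [] [] = M , []
  extend M (e ∷ es) (e-coh ∷ es-coh) with extend M es es-coh
  ... | M₁ , uses₁ with reassign M₁ e
  ...   | M₂ , uses-e , keeps =
    M₂ , uses-e ∷ All.zipWith (λ {e'} (use , coh) → keeps {e'} use (coherent-sym coh)) (uses₁ , e-coh)

  edge : EdgeH a b i j → Edge
  edge (i< , j< , eq) = (fromℕ< i< , fromℕ< j<) , eq

  edge-coherent : (e : EdgeH a b i j) (e' : EdgeH a b i' j') →
    Coherent (i , j) (i' , j') → Coherent (proj₁ (edge e)) (proj₁ (edge e'))
  edge-coherent (i< , j< , _) (i'< , j'< , _) (row , col) =
    (λ eq → fromℕ<-cong _ _ (row (fromℕ<-injective _ _ i< i'< eq)) j< j'<) ,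
    (λ eq → fromℕ<-cong _ _ (col (fromℕ<-injective _ _ j< j'< eq)) i< i'<)

  uses⇒contains : (M : PerfectMatching a b) (e : EdgeH a b i j) →
    Uses M (edge e) → Contains a b M i j
  uses⇒contains M (i< , j< , _) use =
    fromℕ< i< , toℕ-fromℕ< i< , trans (cong toℕ use) (toℕ-fromℕ< j<)

  coherent⇒compatible : IsPermOf a b → InV a b x → InV a b y →
    Coherent x y → Coherent x (next y) → Coherent (next x) y → Coherent (next x) (next y) →
    Compatible a b x y
  coherent⇒compatible {x} {y} (σ , bσ) (ex , ex') (ey , ey') c₁₁ c₁₂ c₂₁ c₂₂
    with extend M₀ (edge ex ∷ edge ex' ∷ edge ey ∷ edge ey' ∷ [])
           ((edge-coherent ex ex' (coherent-next x) ∷ edge-coherent ex ey c₁₁ ∷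
             edge-coherent ex ey' c₁₂ ∷ []) ∷
            (edge-coherent ex' ey c₂₁ ∷ edge-coherent ex' ey' c₂₂ ∷ []) ∷
            (edge-coherent ey ey' (coherent-next y) ∷ []) ∷ [] ∷ [])
    where
    M₀ : PerfectMatching a b
    M₀ = flip σ , λ k → sym (trans (bσ (σ ⟨$⟩ˡ k)) (cong a (inverseʳ σ)))
  ... | M , (u₁ ∷ u₂ ∷ u₃ ∷ u₄ ∷ []) =
    M , uses⇒contains M ex u₁ , uses⇒contains M ex' u₂ ,
        uses⇒contains M ey u₃ , uses⇒contains M ey' u₄

  conflict-excluded : (M : PerfectMatching a b) →
    Contains a b M p q → Contains a b M p' q' → ¬ Conflict (p , q) (p' , q')
  conflict-excluded (π , _) (k , refl , refl) (k' , k'≡ , πk'≡) (inj₁ (p≡ , q≢))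
    with toℕ-injective (trans p≡ (sym k'≡))
  ... | refl = q≢ πk'≡
  conflict-excluded (π , _) (k , refl , refl) (k' , refl , πk'≡) (inj₂ (p≢ , q≡)) =
    p≢ (cong toℕ (Injection.injective (↔⇒↣ π) (toℕ-injective (trans q≡ (sym πk'≡)))))

  slot⇒adjacent : Slot s x y → Adj a b x y
  slot⇒adjacent sxy = slot⇒≢ sxy , incompatible sxy
    where
    incompatible : Slot s x y → ¬ Compatible a b x y
    incompatible (sameRow q≢j)  (M , c₁ , _ , c₃ , _) = conflict-excluded M c₁ c₃ (inj₁ (refl , ≢-sym q≢j))
    incompatible (sameCol p≢i)  (M , c₁ , _ , c₃ , _) = conflict-excluded M c₁ c₃ (inj₂ (≢-sym p≢i , refl))
    incompatible (rowAbove q≢j) (M , c₁ , _ , _ , c₄) = conflict-excluded M c₁ c₄ (inj₁ (refl , ≢-sym q≢j))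
    incompatible (colLeft p≢i)  (M , c₁ , _ , _ , c₄) = conflict-excluded M c₁ c₄ (inj₂ (≢-sym p≢i , refl))
    incompatible (rowBelow q≢j) (M , _ , c₂ , c₃ , _) = conflict-excluded M c₂ c₃ (inj₁ (refl , ≢-sym q≢j))
    incompatible (colRight p≢i) (M , _ , c₂ , c₃ , _) = conflict-excluded M c₂ c₃ (inj₂ (≢-sym p≢i , refl))

  adjacent⇒slot : IsPermOf a b → InV a b x → InV a b y → Adj a b x y → Σ (Fin 5) λ s → Slot s x y
  adjacent⇒slot {x} {y} perm xV yV (_ , incompatible)
    with conflict-or-coherent x y | conflict-or-coherent x (next y)
       | conflict-or-coherent (next x) y | conflict-or-coherent (next x) (next y)
  ... | inj₁ c | _ | _ | _ = slot-first-first c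
  ... | inj₂ _ | inj₁ c | _ | _ = slot-first-second y c
  ... | inj₂ _ | inj₂ _ | inj₁ c | _ = slot-second-first x c
  ... | inj₂ _ | inj₂ _ | inj₂ _ | inj₁ c = slot-second-second x y c
  ... | inj₂ c₁₁ | inj₂ c₁₂ | inj₂ c₂₁ | inj₂ c₂₂ =
    contradiction (coherent⇒compatible perm xV yV c₁₁ c₁₂ c₂₁ c₂₂) incompatible

-- The abstract setting of the combinatorial argument: a relation p ∼ q
-- (standing for a_p = b_q) that is closed under completing rectangles, meets
-- every row and column at most twice, and whose vertex set has no square.
record SquareFreeGrid : Set₁ where
  field
    _∼_       : ℕ → ℕ → Set
    rectangle : p ∼ q → p' ∼ q → p' ∼ q' → p ∼ q'
    row-twice : ∀ {q₁ q₂ q₃} → p ∼ q₁ → p ∼ q₂ → p ∼ q₃ → q₁ ≢ q₃ → q₂ ≢ q₃ → q₁ ≡ q₂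
    col-twice : ∀ {p₁ p₂ p₃} → p₁ ∼ q → p₂ ∼ q → p₃ ∼ q → p₁ ≢ p₃ → p₂ ≢ p₃ → p₁ ≡ p₂

  IsVertex : Vtx → Set
  IsVertex (i , j) = i ∼ j × suc i ∼ suc j

  field
    squareFree : i ≢ i' → j ≢ j' →
      IsVertex (i , j) → IsVertex (i , j') → IsVertex (i' , j) → IsVertex (i' , j') → ⊥

transposeGrid : SquareFreeGrid → SquareFreeGrid
transposeGrid G = record
  { _∼_        = λ p q → q ∼ p
  ; rectangle  = λ pq p'q p'q' → rectangle p'q' p'q pq
  ; row-twice  = col-twice
  ; col-twice  = row-twice
  ; squareFree = λ i≢ j≢ v₁₁ v₁₂ v₂₁ v₂₂ → squareFree j≢ i≢ v₁₁ v₂₁ v₁₂ v₂₂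
  }
  where open SquareFreeGrid G

module Neighbourhood (G : SquareFreeGrid) where
  open SquareFreeGrid G

  Occupied : Fin 5 → Vtx → Set
  Occupied s v = Σ Vtx λ u → IsVertex u × Slot s v u

  -- A vertex with a second vertex in its row and one in its column spans a
  -- square (the fourth corner is obtained by completing rectangles).
  rowCol-square : IsVertex (i , j) → IsVertex (i , q) → IsVertex (p , j) → q ≢ j → p ≢ i → ⊥
  rowCol-square (v₁ , v₂) (r₁ , r₂) (c₁ , c₂) q≢j p≢i =
    squareFree (≢-sym p≢i) (≢-sym q≢j) (v₁ , v₂) (r₁ , r₂) (c₁ , c₂)
      (rectangle c₁ v₁ r₁ , rectangle c₂ v₂ r₂)

  slot-unique : IsVertex v → Slot s v u → Slot s v u' → IsVertex u → IsVertex u' → u ≡ u'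
  slot-unique (v₁ , _) (sameRow q≢j) (sameRow q'≢j) (u₁ , _) (u'₁ , _) =
    cong (_ ,_) (row-twice u₁ u'₁ v₁ q≢j q'≢j)
  slot-unique (v₁ , _) (sameCol p≢i) (sameCol p'≢i) (u₁ , _) (u'₁ , _) =
    cong (_, _) (col-twice u₁ u'₁ v₁ p≢i p'≢i)
  slot-unique vV (sameRow q≢j) (sameCol p≢i) uV u'V = ⊥-elim (rowCol-square vV uV u'V q≢j p≢i)
  slot-unique vV (sameCol p≢i) (sameRow q≢j) uV u'V = ⊥-elim (rowCol-square vV u'V uV q≢j p≢i)
  slot-unique (v₁ , _) (rowAbove q≢j) (rowAbove q'≢j) (_ , u₂) (_ , u'₂) with row-twice u₂ u'₂ v₁ q≢j q'≢j
  ... | refl = refl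
  slot-unique (v₁ , _) (colLeft p≢i) (colLeft p'≢i) (_ , u₂) (_ , u'₂) with col-twice u₂ u'₂ v₁ p≢i p'≢i
  ... | refl = refl
  slot-unique (_ , v₂) (rowBelow q≢j) (rowBelow q'≢j) (u₁ , _) (u'₁ , _) =
    cong (_ ,_) (row-twice u₁ u'₁ v₂ q≢j q'≢j)
  slot-unique (_ , v₂) (colRight p≢i) (colRight p'≢i) (u₁ , _) (u'₁ , _) =
    cong (_, _) (col-twice u₁ u'₁ v₂ p≢i p'≢i)

  -- If the up and left slots of v are occupied, then the diagonal
  -- predecessor of v is not a vertex: those occupants are a row-mate and a
  -- column-mate of it.  Symmetrically for the successor, down and right.
  predecessor-absent : IsVertex (p , q) → Occupied up (suc p , suc q) → Occupied left (suc p , suc q) → ⊥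
  predecessor-absent uV (_ , rV , rowAbove q≢) (_ , cV , colLeft p≢) =
    rowCol-square uV rV cV (q≢ ∘ cong suc) (p≢ ∘ cong suc)

  successor-absent : IsVertex (suc i , suc j) → Occupied down (i , j) → Occupied right (i , j) → ⊥
  successor-absent uV (_ , rV , rowBelow q≢) (_ , cV , colRight p≢) = rowCol-square uV rV cV q≢ p≢

  leftOfMate-absent : IsVertex (i , j) → IsVertex (i , suc q) → suc q ≢ j → suc p ≢ i →
    IsVertex (p , q) → Occupied up (i , j) → Occupied left (i , j) → ⊥
  leftOfMate-absent (v₁ , _) (w₁ , _) r≢j p≢i (u₁ , u₂) (_ , (a₁ , a₂) , rowAbove a≢) (_ , (c₁ , c₂) , colLeft c≢)
    with row-twice a₂ w₁ v₁ a≢ r≢j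
  ... | refl with col-twice c₂ (rectangle u₂ w₁ v₁) v₁ c≢ p≢i
  ...   | refl =
    squareFree (p≢i ∘ cong suc ∘ sym) (r≢j ∘ cong suc)
      (a₁ , a₂) (rectangle a₁ u₁ c₁ , v₁) (u₁ , u₂) (c₁ , c₂)

  rightOfMate-absent : IsVertex (i , j) → IsVertex (i , r) → r ≢ j → p ≢ suc i →
    IsVertex (p , suc r) → Occupied down (i , j) → Occupied right (i , j) → ⊥
  rightOfMate-absent (_ , v₂) (_ , w₂) r≢j p≢i (u₁ , u₂) (_ , (d₁ , d₂) , rowBelow d≢) (_ , (c₁ , c₂) , colRight c≢)
    with row-twice d₁ w₂ v₂ d≢ (r≢j ∘ suc-injective)
  ... | refl with col-twice (rectangle c₁ v₂ w₂) u₁ w₂ c≢ p≢i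
  ...   | refl =
    squareFree (≢-sym p≢i) (r≢j ∘ suc-injective ∘ sym)
      (v₂ , rectangle d₂ u₂ c₂) (d₁ , d₂) (c₁ , c₂) (u₁ , u₂)

  rowMate-lonely : IsVertex (i , j) → IsVertex (i , r) → r ≢ j →
    Occupied up (i , j) → Occupied left (i , j) → Occupied down (i , j) → Occupied right (i , j) →
    ∀ s u → IsVertex u → Slot s (i , r) u → u ≡ (i , j)
  rowMate-lonely (v₁ , _) (w₁ , _) r≢j _ _ _ _ _ _ (u₁ , _) (sameRow q≢r) =
    cong (_ ,_) (row-twice u₁ v₁ w₁ q≢r (≢-sym r≢j))
  rowMate-lonely vV wV r≢j _ _ _ _ _ _ uV (sameCol p≢i) =
    ⊥-elim (rowCol-square wV vV uV (≢-sym r≢j) p≢i)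
  rowMate-lonely (v₁ , _) (w₁ , _) r≢j oUp oLeft _ _ _ _ uV@(_ , u₂) (rowAbove q≢r)
    with row-twice u₂ v₁ w₁ q≢r (≢-sym r≢j)
  ... | refl = ⊥-elim (predecessor-absent uV oUp oLeft)
  rowMate-lonely vV wV r≢j oUp oLeft _ _ _ _ uV (colLeft p≢i) =
    ⊥-elim (leftOfMate-absent vV wV r≢j p≢i uV oUp oLeft)
  rowMate-lonely (_ , v₂) (_ , w₂) r≢j _ _ oDown oRight _ _ uV@(u₁ , _) (rowBelow q≢r)
    with row-twice u₁ v₂ w₂ q≢r (≢-sym (r≢j ∘ suc-injective))
  ... | refl = ⊥-elim (successor-absent uV oDown oRight)
  rowMate-lonely vV wV r≢j _ _ oDown oRight _ _ uV (colRight p≢i) =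
    ⊥-elim (rightOfMate-absent vV wV r≢j p≢i uV oDown oRight)

-- A column
-- occupant is a row occupant of the transposed grid.
lonely-neighbour : (G : SquareFreeGrid) → let open SquareFreeGrid G; open Neighbourhood G in
  IsVertex v → (∀ s → Occupied s v) →
  Σ Vtx λ w → IsVertex w × Slot line v w × Slot line w v × (∀ s u → IsVertex u → Slot s w u → u ≡ v)
lonely-neighbour G vV occ with occ line
... | w , wV , sameRow r≢j =
  w , wV , sameRow r≢j , sameRow (≢-sym r≢j) ,
  rowMate-lonely vV wV r≢j (occ up) (occ left) (occ down) (occ right)
  where open Neighbourhood G
... | w , wV , sameCol p≢i =
  w , wV , sameCol p≢i , sameCol (≢-sym p≢i) ,
  λ s u uV swu → cong swap (Transposed.rowMate-lonely vV wV p≢i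
    (transposed left) (transposed up) (transposed right) (transposed down)
    (swapSlot s) (swap u) uV (slot-swap swu))
  where
  module Transposed = Neighbourhood (transposeGrid G)
  transposed : ∀ s → Transposed.Occupied (swapSlot s) (swap _)
  transposed s with occ s
  ... | u , uV , svu = swap u , uV , slot-swap svu

-- An injective endofunction of a finite set is surjective: otherwise it
-- would inject Fin (suc m) into the m values other than the missed one.
injective⇒surjective : ∀ {n} (f : Fin n → Fin n) → Injective _≡_ _≡_ f → ∀ c → ∃ λ k → f k ≡ c
injective⇒surjective {suc m} f f-inj c with any? (λ k → f k ≟ᶠ c)
... | yes hit = hit
... | no miss = contradiction (injective⇒≤ avoid-injective) 1+n≰n
  where
  c≢f : ∀ k → c ≢ f k
  c≢f k = miss ∘ (k ,_) ∘ sym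
  avoid : Fin (suc m) → Fin m
  avoid k = punchOut (c≢f k)
  avoid-injective : Injective _≡_ _≡_ avoid
  avoid-injective {k} {l} eq = f-inj (punchOut-injective (c≢f k) (c≢f l) eq)

unique-lookup-injective : {A : Set} {xs : List A} → Unique xs → Injective _≡_ _≡_ (lookup xs)
unique-lookup-injective (_ ∷ _)    {Fin.zero}  {Fin.zero}  _  = refl
unique-lookup-injective (x∉ ∷ _)   {Fin.zero}  {Fin.suc l} eq = contradiction eq (All.lookup x∉ (∈-lookup l))
unique-lookup-injective (x∉ ∷ _)   {Fin.suc k} {Fin.zero}  eq = contradiction (sym eq) (All.lookup x∉ (∈-lookup k))
unique-lookup-injective (_ ∷ uniq) {Fin.suc k} {Fin.suc l} eq = cong Fin.suc (unique-lookup-injective uniq eq)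

every-class-hit : {A : Set} {n : ℕ} (P : Fin n → A → Set) (xs : List A) →
  length xs ≡ n → Unique xs →
  (∀ {x} → x ∈ xs → Σ (Fin n) λ c → P c x) →
  (∀ {c x y} → x ∈ xs → y ∈ xs → P c x → P c y → x ≡ y) →
  ∀ c → Σ A λ x → x ∈ xs × P c x
every-class-hit P xs refl uniq classOf at-most-one c
  with injective⇒surjective class class-injective c
  where
  class : Fin (length xs) → Fin (length xs)
  class k = proj₁ (classOf (∈-lookup k))
  class-injective : Injective _≡_ _≡_ class
  class-injective {k} {l} eq = unique-lookup-injective uniq
    (at-most-one (∈-lookup k) (∈-lookup l) (proj₂ (classOf (∈-lookup k)))
      (subst (λ c → P c (lookup xs l)) (sym eq) (proj₂ (classOf (∈-lookup l)))))
... | k , refl = lookup xs k , ∈-lookup k , proj₂ (classOf (∈-lookup k))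

letterGrid : {L : Set} {n : ℕ} (a b : Str L n) →
  AtMostTwice a → AtMostTwice b → ¬ HasSquare a b → SquareFreeGrid
letterGrid {n = n} a b twiceA twiceB noSquare = record
  { _∼_        = EdgeH a b
  ; rectangle  = λ (p< , _ , e₁) (_ , _ , e₂) (_ , q'< , e₃) → p< , q'< , trans e₁ (trans (sym e₂) e₃)
  ; row-twice  = row-twice
  ; col-twice  = col-twice
  ; squareFree = λ {i} {i'} {j} {j'} i≢ j≢ v₁₁ v₁₂ v₂₁ v₂₂ →
                   noSquare (i , i' , j , j' , i≢ , j≢ , v₁₁ , v₁₂ , v₂₁ , v₂₂)
  }
  where
  fromℕ<-≢ : ∀ {k l} .(k< : k < n) .(l< : l < n) → k ≢ l → fromℕ< k< ≢ fromℕ< l<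
  fromℕ<-≢ k< l< k≢l = k≢l ∘ fromℕ<-injective _ _ k< l<

  row-twice : ∀ {p q₁ q₂ q₃} → EdgeH a b p q₁ → EdgeH a b p q₂ → EdgeH a b p q₃ → q₁ ≢ q₃ → q₂ ≢ q₃ → q₁ ≡ q₂
  row-twice {q₁ = q₁} {q₂} (_ , q₁< , e₁) (_ , q₂< , e₂) (_ , q₃< , e₃) q₁≢q₃ q₂≢q₃ with q₁ ≟ q₂
  ... | yes q₁≡q₂ = q₁≡q₂
  ... | no q₁≢q₂ = ⊥-elim (twiceB _ _ _ (fromℕ<-≢ q₁< q₂< q₁≢q₂) (fromℕ<-≢ q₁< q₃< q₁≢q₃)
                     (fromℕ<-≢ q₂< q₃< q₂≢q₃) (trans (sym e₁) e₂ , trans (sym e₂) e₃))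

  col-twice : ∀ {p₁ p₂ p₃ q} → EdgeH a b p₁ q → EdgeH a b p₂ q → EdgeH a b p₃ q → p₁ ≢ p₃ → p₂ ≢ p₃ → p₁ ≡ p₂
  col-twice {p₁} {p₂} (p₁< , _ , e₁) (p₂< , _ , e₂) (p₃< , _ , e₃) p₁≢p₃ p₂≢p₃ with p₁ ≟ p₂
  ... | yes p₁≡p₂ = p₁≡p₂
  ... | no p₁≢p₂ = ⊥-elim (twiceA _ _ _ (fromℕ<-≢ p₁< p₂< p₁≢p₂) (fromℕ<-≢ p₁< p₃< p₁≢p₃)
                     (fromℕ<-≢ p₂< p₃< p₂≢p₃) (trans e₁ (sym e₂) , trans e₂ (sym e₃)))

corollary2p6 : {L : Set} (n : ℕ) (a b : Str L n) →
    IsPermOf a b → AtMostTwice a → AtMostTwice b →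
    ¬ HasSquare a b →
    (v : Vtx) → InV a b v → HasDegree a b v 5 →
    Σ Vtx λ w → InV a b w × Adj a b v w × HasDegree a b w 1
corollary2p6 n a b perm twiceA twiceB noSquare v vV (nbrs , five , uniq , nbr⇔) =
  let (w , wV , v∼w , w∼v , only-v) = lonely-neighbour grid vV occupied in
  w , wV , slot⇒adjacent v∼w , (v ∷ [] , refl , [] ∷ [] , λ u → mk⇔
    (λ { (here refl) → vV , slot⇒adjacent w∼v })
    (λ (uV , w∼u) → here (only-v _ u uV (proj₂ (adjacent⇒slot perm wV uV w∼u)))))
  where
  grid : SquareFreeGrid
  grid = letterGrid a b twiceA twiceB noSquare
  open Matchings a b
  open Neighbourhood grid
  neighbour : ∀ {u} → u ∈ nbrs → InV a b u × Adj a b v u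
  neighbour = Equivalence.to (nbr⇔ _)
  -- by pigeonhole over the five slots, each slot of v holds a neighbour
  occupied : ∀ s → Occupied s v
  occupied s with every-class-hit (λ s u → Slot s v u) nbrs five uniq
                    (λ u∈ → adjacent⇒slot perm vV (proj₁ (neighbour u∈)) (proj₂ (neighbour u∈)))
                    (λ u∈ u'∈ svu svu' → slot-unique vV svu svu' (proj₁ (neighbour u∈)) (proj₁ (neighbour u'∈)))
                    s
  ... | u , u∈ , svu = u , proj₁ (neighbour u∈) , svu
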